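{- Let $P=(Q,\Sigma,q_{in},\Delta)$ be a $2$-phase-bounded protocol and $q_f\in Q$. If $q_f$ can be covered with a tree topology, then it can be covered with a tree topology $\Gamma$ such that $|u|\le|Q|+1$ for every vertex $u$ of $\Gamma$.
   Context: A broadcast protocol is $P=(Q,\Sigma,q_{in},\Delta)$ with finite $Q$, finite $\Sigma$, $q_{in}\in Q$, $\Delta\subseteq Q\times(\{!!m\}\cup\{?m\}\cup\{\tau\})\times Q$ ($m\in\Sigma$; broadcast, reception, internal). $R(q)=\{m:\exists q',(q,?m,q')\in\Delta\}$. Topologies are finite undirected graphs without self-loops; configurations $(\Gamma,L)$ with $L:V(\Gamma)\to Q$, initial if all labels are $q_{in}$. $C=(\Gamma,L)\xrightarrow{v,\delta}C'=(\Gamma,L')$ for $\delta=(q,\alpha,q')$ if $L(v)=q$, $L'(v)=q'$ and either $\alpha=\tau$ and other labels unchanged, or $\alpha=!!m$, every neighbour $u$ of $v$ satisfies $(L(u),?m,L'(u))\in\Delta$ or ($m\notin R(L(u))$ and $L'(u)=L(u)$), and non-neighbours other than $v$ are unchanged; $\to^*$ is the reflexive transitive closure. $q_f$ is covered (coverable) with $\Gamma$ if some initial $(\Gamma,L)\to^*(\Gamma,L')$ with $L'(v)=q_f$ for some vertex $v$. A tree topology has as vertex set a finite prefix-closed set $V\subseteq\mathbb{N}^*$ containing the empty word $\epsilon$, with edges exactly between each $w\in V\setminus\{\epsilon\}$ and $w$ with its last letter removed; $|u|$ is the length of the word $u$. $P$ is $2$-phase-bounded if $Q$ can be partitioned into $Q_0,Q_1^b,Q_1^r,Q_2^b,Q_2^r$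 with $q_{in}\in Q_0$ (convention $Q_0^b=Q_0^r=Q_0$) such that every $(q,\alpha,q')\in\Delta$ satisfies one of: (1) $q,q'\in Q_i^\beta$ for some $0\le i\le2$, $\beta\in\{r,b\}$, $\alpha=\tau$; (2) $q,q'\in Q_i^b$, $1\le i\le2$, $\alpha$ a broadcast; (3) $q,q'\in Q_i^r$, $1\le i\le2$, $\alpha$ a reception; (4) $q\in Q_i^b,q'\in Q_{i+1}^r$, $0\le i<2$, $\alpha$ a reception; (5) $q\in Q_i^r,q'\in Q_{i+1}^b$, $0\le i<2$, $\alpha$ a broadcast; (6) $q\in Q_2^b,q'\in Q_2^r$, $\alpha$ a reception. -}

module Defs where

open import Data.Nat using (ℕ; zero; suc; _≤_; _<_)
open import Data.Fin using (Fin)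
open import Data.List using (List; []; _∷_; _++_; [_]; length)
open import Data.List.Membership.Propositional using (_∈_)
open import Data.Product using (Σ; ∃; ∃-syntax; _×_; _,_)
open import Data.Sum using (_⊎_)
open import Relation.Nullary using (¬_)
open import Relation.Binary.PropositionalEquality using (_≡_; _≢_)
open import Relation.Binary.Construct.Closure.ReflexiveTransitive using (Star)

data Action (nΣ : ℕ) : Set where
  bcast : Fin nΣ → Action nΣ
  recv  : Fin nΣ → Action nΣ
  tau   : Action nΣ

record Protocol : Set where
  field
    nQ  : ℕ
    nΣ  : ℕ
    qin : Fin nQ
    Δ   : List (Fin nQ × Action nΣ × Fin nQ)

module _ (P : Protocol) where
  open Protocol P

  InR : Fin nQ → Fin nΣ → Set
  InR q m = ∃[ q' ] ((q , recv m , q') ∈ Δ)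

  record TreeTopology : Set where
    field
      V            : List (List ℕ)
      root∈        : [] ∈ V
      prefixClosed : ∀ (u w : List ℕ) → (u ++ w) ∈ V → u ∈ V

  Adj : List ℕ → List ℕ → Set
  Adj u v = (∃[ k ] (u ≡ v ++ [ k ])) ⊎ (∃[ k ] (v ≡ u ++ [ k ]))

  -- labellings (values outside V are irrelevant and kept unchanged by steps)
  Labelling : Set
  Labelling = List ℕ → Fin nQ

  StepEffect : TreeTopology → List ℕ → Action nΣ → Labelling → Labelling → Set
  StepEffect Γ v tau L L' = ∀ u → u ≢ v → L' u ≡ L u
  StepEffect Γ v (bcast m) L L' =
    ∀ u → u ≢ v →
      ((u ∈ TreeTopology.V Γ × Adj v u) →
         ((L u , recv m , L' u) ∈ Δ) ⊎ ((¬ InR (L u) m) × L' u ≡ L u))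
      × (¬ (u ∈ TreeTopology.V Γ × Adj v u) → L' u ≡ L u)
  StepEffect Γ v (recv m) L L' = Data.Empty.⊥
    where import Data.Empty

  Step : TreeTopology → Labelling → Labelling → Set
  Step Γ L L' =
    ∃[ v ] ∃[ q ] ∃[ α ] ∃[ q' ]
      ( v ∈ TreeTopology.V Γ
      × (q , α , q') ∈ Δ
      × L v ≡ q × L' v ≡ q'
      × StepEffect Γ v α L L')

  initial : Labelling
  initial _ = qin

  CoverableWith : TreeTopology → Fin nQ → Set
  CoverableWith Γ qf =
    ∃[ L' ] (Star (Step Γ) initial L' × ∃[ v ] (v ∈ TreeTopology.V Γ × L' v ≡ qf))

  DepthBounded : TreeTopology → ℕ → Set
  DepthBounded Γ b = ∀ u → u ∈ TreeTopology.V Γ → length u ≤ b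

data Part : Set where
  p0 p1b p1r p2b p2r : Part

data Colour : Set where
  b r : Colour

-- p ∈ Q_i^β  (with Q_0^b = Q_0^r = Q_0)
data In : ℕ → Colour → Part → Set where
  in0  : ∀ {β} → In 0 β p0
  in1b : In 1 b p1b
  in1r : In 1 r p1r
  in2b : In 2 b p2b
  in2r : In 2 r p2r

data IsBcast {nΣ : ℕ} : Action nΣ → Set where
  isB : ∀ m → IsBcast (bcast m)

data IsRecv {nΣ : ℕ} : Action nΣ → Set where
  isR : ∀ m → IsRecv (recv m)

data Allowed {nΣ : ℕ} (p : Part) (α : Action nΣ) (p' : Part) : Set where
  c1 : ∀ i β → i ≤ 2 → In i β p → In i β p' → α ≡ tau → Allowed p α p'
  c2 : ∀ i → 1 ≤ i → i ≤ 2 → In i b p → In i b p' → IsBcast α → Allowed p α p'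
  c3 : ∀ i → 1 ≤ i → i ≤ 2 → In i r p → In i r p' → IsRecv α → Allowed p α p'
  c4 : ∀ i → i < 2 → In i b p → In (suc i) r p' → IsRecv α → Allowed p α p'
  c5 : ∀ i → i < 2 → In i r p → In (suc i) b p' → IsBcast α → Allowed p α p'
  c6 : In 2 b p → In 2 r p' → IsRecv α → Allowed p α p'

TwoPhaseBounded : Protocol → Set
TwoPhaseBounded P =
  Σ (Fin nQ → Part) λ part → ( part qin ≡ p0
            × (∀ (q : Fin nQ) (α : Action nΣ) (q' : Fin nQ) → (q , α , q') ∈ Δ → Allowed (part q) α (part q')))
  where open Protocol P

{-# OPTIONS --safe #-}
module Submission where

-- In a 2-phase-bounded protocol a process is silent (in Q₀ ∪ Q₁ʳ) until its first broadcast, and a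
-- process that has broadcast is sent by any reception to Q₂ʳ, where it never broadcasts again.
-- Consider an edge c — d of a tree, d the child. While both are silent, the subtree at d evolves in
-- isolation; so if d broadcasts no later than c, the subtree may be replaced by any tree whose root
-- reaches the same silent state. If c broadcasts first, all the subtree can still do to the rest of
-- the tree is retire c, so it may be removed at the price of c's own state. On a branch of length
-- |Q| of a run whose root ends in a silent state, the states of the branch vertices at the moment
-- they stop being isolated, together with the final root state, are |Q| + 1 silent states; two
-- coincide and the branch can be cut short. So a silent root state is reached on a tree of depth
-- < |Q|. For an arbitrary target state, re-root the tree at the covering vertex and apply this
-- below every grandchild of the root, which bounds the depth by |Q| + 1.

open import Defs
open import Level using (0ℓ)
open import Data.Empty using (⊥; ⊥-elim)
open import Data.Nat using (ℕ; zero; suc; _+_; _≤_; _<_; z≤n; s≤s)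
import Data.Nat.Properties as ℕ
open import Data.Nat.Induction using (<-wellFounded)
open import Data.Fin as Fin using (Fin; toℕ)
open import Data.Fin.Properties using (pigeonhole; toℕ<n)
open import Data.List using (List; []; _∷_; _++_; [_]; length; map; filter; take; drop; initLast; _∷ʳ′_)
open import Data.List.Properties
  using (≡-dec; ++-assoc; ++-identityʳ; ++-conicalˡ; ++-conicalʳ; ++-cancelˡ; ∷-injectiveˡ; ∷-injectiveʳ; ∷ʳ-injectiveˡ;
         length-++; length-map; length-take; take++drop≡id; take-take; filter-notAll; filter-++; filter-none)
open import Data.List.Relation.Unary.Any using (Any; here; there; any?)
import Data.List.Relation.Unary.All as All
open import Data.List.Membership.Propositional using (_∈_; find; lose)
open import Data.List.Membership.Propositional.Properties
  using (∈-map⁺; ∈-map⁻; ∈-filter⁺; ∈-filter⁻; ∈-++⁺ˡ; ∈-++⁺ʳ; ∈-++⁻)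
open import Data.Product using (∃-syntax; _×_; _,_; proj₁; proj₂)
open import Data.Sum using (_⊎_; inj₁; inj₂; swap)
open import Function using (_∘_)
open import Function.Bundles using (_⇔_; mk⇔; Equivalence)
open import Induction.WellFounded using (Acc; acc)
open import Relation.Nullary using (¬_; Dec; yes; no; contradiction; ¬?)
open import Relation.Nullary.Decidable using (map′; _×-dec_; _⊎-dec_; decidable-stable)
open import Relation.Unary using (Pred; Decidable; _⊆_; _∩_; ∁)
open import Relation.Unary.Properties using (_∩?_; ∁?)
open import Relation.Binary.PropositionalEquality
  using (_≡_; _≢_; refl; sym; trans; cong; subst; subst₂; module ≡-Reasoning)
open import Relation.Binary.Construct.Closure.ReflexiveTransitive using (Star; ε; _◅_; _◅◅_; gmap)

module _ {A : Set} {P : Pred A 0ℓ} (P? : Decidable P) where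

  length-filter-∁ : ∀ xs → length (filter (∁? P?) xs) + length (filter P? xs) ≡ length xs
  length-filter-∁ []       = refl
  length-filter-∁ (x ∷ xs) with P? x
  ... | yes _ = trans (ℕ.+-suc _ _) (cong suc (length-filter-∁ xs))
  ... | no _  = cong suc (length-filter-∁ xs)

module _ {A : Set} {P Q : Pred A 0ℓ} (P? : Decidable P) (Q? : Decidable Q) where

  length-filter-⊆ : P ⊆ Q → ∀ xs → length (filter P? xs) ≤ length (filter Q? xs)
  length-filter-⊆ P⊆Q []       = z≤n
  length-filter-⊆ P⊆Q (x ∷ xs) with P? x | Q? x
  ... | yes _  | yes _  = s≤s (length-filter-⊆ P⊆Q xs)
  ... | yes px | no ¬qx = contradiction (P⊆Q px) ¬qx
  ... | no _   | yes _  = ℕ.m≤n⇒m≤1+n (length-filter-⊆ P⊆Q xs)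
  ... | no _   | no _   = length-filter-⊆ P⊆Q xs

  length-filter-⊂ : P ⊆ Q → ∀ {xs} → Any (Q ∩ ∁ P) xs → length (filter P? xs) < length (filter Q? xs)
  length-filter-⊂ P⊆Q {x ∷ xs} (here (qx , ¬px)) with P? x | Q? x
  ... | yes px | _      = contradiction px ¬px
  ... | no _   | yes _  = s≤s (length-filter-⊆ P⊆Q xs)
  ... | no _   | no ¬qx = contradiction qx ¬qx
  length-filter-⊂ P⊆Q {x ∷ xs} (there any) with P? x | Q? x
  ... | yes _  | yes _  = s≤s (length-filter-⊂ P⊆Q any)
  ... | yes px | no ¬qx = contradiction (P⊆Q px) ¬qx
  ... | no _   | yes _  = ℕ.m<n⇒m<1+n (length-filter-⊂ P⊆Q any)
  ... | no _   | no _   = length-filter-⊂ P⊆Q any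

  filter-filter : ∀ xs → filter P? (filter Q? xs) ≡ filter (P? ∩? Q?) xs
  filter-filter []       = refl
  filter-filter (x ∷ xs) with Q? x
  ... | no _ with P? x
  ...   | yes _ = filter-filter xs
  ...   | no _  = filter-filter xs
  filter-filter (x ∷ xs) | yes _ with P? x
  ...   | yes _ = cong (x ∷_) (filter-filter xs)
  ...   | no _  = filter-filter xs

module _ {A B : Set} {S : A → A → Set} {T : B → B → Set} (R : B → A → Set) where

  simulate : (∀ {y x x′} → R y x → S x x′ → ∃[ y′ ] (Star T y y′ × R y′ x′)) →
             ∀ {y x x′} → R y x → Star S x x′ → ∃[ y′ ] (Star T y y′ × R y′ x′)
  simulate sim rel ε = _ , ε , rel
  simulate sim rel (s ◅ ss) with sim rel s
  ... | _ , ts , rel₁ with simulate sim rel₁ ss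
  ...   | y′ , ts′ , rel′ = y′ , ts ◅◅ ts′ , rel′

Within : {A : Set} → (A → A → Set) → (A → Set) → A → A → Set
Within S C a a′ = C a × S a a′ × C a′

module _ {A : Set} {S : A → A → Set} {C : A → Set} where

  within-forward : (∀ {a a′} → S a a′ → C a → C a′) → ∀ {a a′} → Star S a a′ → C a → Star (Within S C) a a′
  within-forward fwd ε        c = ε
  within-forward fwd (s ◅ ss) c = (c , s , fwd s c) ◅ within-forward fwd ss (fwd s c)

  within-backward : (∀ {a a′} → S a a′ → C a′ → C a) →
                    ∀ {a a′} → Star S a a′ → C a′ → C a × Star (Within S C) a a′
  within-backward bwd ε        c = c , ε
  within-backward bwd (s ◅ ss) c with c₁ , ws ← within-backward bwd ss c = bwd s c₁ , (bwd s c₁ , s , c₁) ◅ ws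

all-or-any : ∀ n {A B : ℕ → Set} → (∀ i → i < n → A i ⊎ B i) → (∀ i → i < n → A i) ⊎ ∃[ i ] (i < n × B i)
all-or-any zero    _      = inj₁ λ _ ()
all-or-any (suc n) {A} either with all-or-any n (λ i i<n → either i (ℕ.m<n⇒m<1+n i<n)) | either n (ℕ.n<1+n n)
... | inj₂ (i , i<n , Bi) | _       = inj₂ (i , ℕ.m<n⇒m<1+n i<n , Bi)
... | inj₁ _              | inj₂ Bn = inj₂ (n , ℕ.n<1+n n , Bn)
... | inj₁ As             | inj₁ An = inj₁ λ i i<1+n → extend (ℕ.m<1+n⇒m<n∨m≡n i<1+n)
  where
  extend : ∀ {i} → i < n ⊎ i ≡ n → A i
  extend (inj₁ i<n)  = As _ i<n
  extend (inj₂ refl) = An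

data Quiet : Part → Set where
  quiet₀  : Quiet p0
  quiet₁ʳ : Quiet p1r

quiet? : Decidable Quiet
quiet? p0  = yes quiet₀
quiet? p1r = yes quiet₁ʳ
quiet? p1b = no λ ()
quiet? p2b = no λ ()
quiet? p2r = no λ ()

tau-stays : ∀ {n p p′} → Allowed {n} p tau p′ → p ≡ p′
tau-stays (c1 _ _ _ in0  in0  _) = refl
tau-stays (c1 _ _ _ in1b in1b _) = refl
tau-stays (c1 _ _ _ in1r in1r _) = refl
tau-stays (c1 _ _ _ in2b in2b _) = refl
tau-stays (c1 _ _ _ in2r in2r _) = refl
tau-stays (c2 _ _ _ _ _ ())
tau-stays (c3 _ _ _ _ _ ())
tau-stays (c4 _ _ _ _ ())
tau-stays (c5 _ _ _ _ ())
tau-stays (c6 _ _ ())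

bcast-¬quiet : ∀ {n p p′ m} → Allowed {n} p (bcast m) p′ → ¬ Quiet p′
bcast-¬quiet (c2 _ _ _ in1b in1b _) ()
bcast-¬quiet (c2 _ _ _ in2b in2b _) ()
bcast-¬quiet (c5 _ _ in0  in1b _) ()
bcast-¬quiet (c5 _ _ in1r in2b _) ()

bcast-not-p2r : ∀ {n p p′ m} → Allowed {n} p (bcast m) p′ → p ≢ p2r
bcast-not-p2r (c2 _ _ _ in1b in1b _) ()
bcast-not-p2r (c2 _ _ _ in2b in2b _) ()
bcast-not-p2r (c5 _ _ in0  in1b _) ()
bcast-not-p2r (c5 _ _ in1r in2b _) ()

recv-quiet : ∀ {n p p′ m} → Allowed {n} p (recv m) p′ → Quiet p → Quiet p′
recv-quiet (c3 _ _ _ in1r in1r _) _ = quiet₁ʳ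
recv-quiet (c4 _ _ in0  in1r _)   _ = quiet₁ʳ
recv-quiet (c6 in2b in2r _)       ()

recv-¬quiet : ∀ {n p p′ m} → Allowed {n} p (recv m) p′ → ¬ Quiet p → p′ ≡ p2r
recv-¬quiet (c3 _ _ _ in1r in1r _) ¬quiet = contradiction quiet₁ʳ ¬quiet
recv-¬quiet (c3 _ _ _ in2r in2r _) ¬quiet = refl
recv-¬quiet (c4 _ _ in0  in1r _)   ¬quiet = contradiction quiet₀ ¬quiet
recv-¬quiet (c4 _ _ in1b in2r _)   ¬quiet = refl
recv-¬quiet (c6 in2b in2r _)       ¬quiet = refl

Word : Set
Word = List ℕ

infix 4 _≼_ _≼?_

_≼_ : Word → Word → Set
x ≼ u = ∃[ w ] (u ≡ x ++ w)

_≼?_ : (x u : Word) → Dec (x ≼ u)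
[]      ≼? u       = yes (u , refl)
(a ∷ x) ≼? []      = no λ ()
(a ∷ x) ≼? (a′ ∷ u) with a ℕ.≟ a′ | x ≼? u
... | yes refl | yes (w , refl) = yes (w , refl)
... | yes refl | no x⋠u         = no λ (w , e) → x⋠u (w , ∷-injectiveʳ e)
... | no a≢a′  | _              = no λ (w , e) → a≢a′ (sym (∷-injectiveˡ e))

≼-refl : ∀ x → x ≼ x
≼-refl x = [] , sym (++-identityʳ x)

≼-trans : ∀ {x y z} → x ≼ y → y ≼ z → x ≼ z
≼-trans {x} (w , refl) (w′ , refl) = w ++ w′ , ++-assoc x w w′

≼-++ : ∀ x w → x ≼ x ++ w
≼-++ x w = w , refl

≼-length : ∀ {x u} → x ≼ u → length x ≤ length u
≼-length {x} (w , refl) = subst (length x ≤_) (sym (length-++ x)) (ℕ.m≤m+n _ _)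

<⇒⋠ : ∀ {x u} → length u < length x → ¬ x ≼ u
<⇒⋠ u<x x≼u = ℕ.<⇒≱ u<x (≼-length x≼u)

≼[]⇒≡[] : ∀ {x} → x ≼ [] → x ≡ []
≼[]⇒≡[] {x} (w , e) = ++-conicalˡ x w (sym e)

take-≼ : ∀ i (u : Word) → take i u ≼ u
take-≼ i u = drop i u , sym (take++drop≡id i u)

take-≼-take : ∀ {i j} (u : Word) → i ≤ j → take i u ≼ take j u
take-≼-take {i} {j} u i≤j =
  subst (_≼ take j u) (trans (take-take i j u) (cong (λ n → take n u) (ℕ.m≤n⇒m⊓n≡m i≤j))) (take-≼ i (take j u))

length-take-≤ : ∀ {i} (u : Word) → i ≤ length u → length (take i u) ≡ i
length-take-≤ {i} u i≤ = trans (length-take i u) (ℕ.m≤n⇒m⊓n≡m i≤)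

take-suc : ∀ {i} (u : Word) → i < length u → ∃[ k ] (take (suc i) u ≡ take i u ++ [ k ])
take-suc {zero}  (a ∷ u) _         = a , refl
take-suc {suc i} (a ∷ u) (s≤s i<u) with k , e ← take-suc u i<u = k , cong (a ∷_) e

_≟ʷ_ : (u v : Word) → Dec (u ≡ v)
_≟ʷ_ = ≡-dec ℕ._≟_

drop-length-++ : ∀ (x w : Word) → drop (length x) (x ++ w) ≡ w
drop-length-++ []      w = refl
drop-length-++ (a ∷ x) w = drop-length-++ x w

≼-comparable : ∀ u w x z → u ++ w ≡ x ++ z → u ≼ x ⊎ x ≼ u
≼-comparable []      w x       z e = inj₁ (x , refl)
≼-comparable (a ∷ u) w []      z e = inj₂ (a ∷ u , refl)
≼-comparable (a ∷ u) w (a′ ∷ x) z e with refl ← ∷-injectiveˡ e with ≼-comparable u w x z (∷-injectiveʳ e)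
... | inj₁ (t , refl) = inj₁ (t , refl)
... | inj₂ (t , refl) = inj₂ (t , refl)

∷ʳ≢[] : ∀ (c : Word) j → c ++ [ j ] ≢ []
∷ʳ≢[] c j e with () ← ++-conicalʳ c [ j ] e

∷ʳ-⋠ : ∀ (c : Word) j → ¬ c ++ [ j ] ≼ c
∷ʳ-⋠ c j = <⇒⋠ (subst (length c <_) (sym (length-++ c)) (ℕ.m<m+n (length c) (s≤s z≤n)))

child≢[] : ∀ {x y : Word} {j} → x ≡ y ++ [ j ] → x ≢ []
child≢[] {y = y} {j} x≡yj = ∷ʳ≢[] y j ∘ trans (sym x≡yj)

module _ (P : Protocol) where

  open Protocol P
  open TreeTopology
  open Equivalence using (to; from)
  open import Data.List.Membership.DecPropositional _≟ʷ_ using (_∈?_)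

  Adj-sym : ∀ {u v} → Adj P u v → Adj P v u
  Adj-sym (inj₁ c) = inj₂ c
  Adj-sym (inj₂ c) = inj₁ c

  Adj-++ : ∀ x {u v} → Adj P u v → Adj P (x ++ u) (x ++ v)
  Adj-++ x {v = v} (inj₁ (k , refl)) = inj₁ (k , sym (++-assoc x v [ k ]))
  Adj-++ x {u = u} (inj₂ (k , refl)) = inj₂ (k , sym (++-assoc x u [ k ]))

  Adj-++⁻ : ∀ x {u v} → Adj P (x ++ u) (x ++ v) → Adj P u v
  Adj-++⁻ x {u} {v} (inj₁ (k , e)) = inj₁ (k , ++-cancelˡ x u (v ++ [ k ]) (trans e (++-assoc x v [ k ])))
  Adj-++⁻ x {u} {v} (inj₂ (k , e)) = inj₂ (k , ++-cancelˡ x v (u ++ [ k ]) (trans e (++-assoc x u [ k ])))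

  child? : (u v : Word) → Dec (∃[ k ] (u ≡ v ++ [ k ]))
  child? u v with initLast u
  ... | []       = no λ (k , e) → contradiction (++-conicalʳ v [ k ] (sym e)) λ ()
  ... | u′ ∷ʳ′ k = map′ (λ { refl → k , refl }) (λ (_ , e) → ∷ʳ-injectiveˡ u′ v e) (u′ ≟ʷ v)

  Adj? : (u v : Word) → Dec (Adj P u v)
  Adj? u v = child? u v ⊎-dec child? v u

  subtree-boundary : ∀ {x y j u v} → x ≡ y ++ [ j ] → x ≼ u → ¬ x ≼ v → Adj P v u → u ≡ x × v ≡ y
  subtree-boundary {x} _ (w , refl) x⋠v (inj₁ (k , refl)) = contradiction (w ++ [ k ] , ++-assoc x w [ k ]) x⋠v
  subtree-boundary {x} {y} {j} {u} {v} x≡yj (w , u≡xw) x⋠v (inj₂ (k , u≡vk)) with initLast w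
  ... | [] = u≡x , ∷ʳ-injectiveˡ v y (trans (sym u≡vk) (trans u≡x x≡yj))
    where u≡x = trans u≡xw (++-identityʳ x)
  ... | w′ ∷ʳ′ l =
    contradiction (w′ , ∷ʳ-injectiveˡ v (x ++ w′) (trans (sym u≡vk) (trans u≡xw (sym (++-assoc x w′ [ l ]))))) x⋠v

  ≼-closed : ∀ (Γ : TreeTopology P) {x u} → x ≼ u → u ∈ V Γ → x ∈ V Γ
  ≼-closed Γ {x} (w , refl) = prefixClosed Γ x w

  size : TreeTopology P → ℕ
  size Γ = length (V Γ)

  below : Word → List Word → List Word
  below x vs = map (drop (length x)) (filter (x ≼?_) vs)

  ∈-below⁺ : ∀ {x w vs} → x ++ w ∈ vs → w ∈ below x vs
  ∈-below⁺ {x} {w} xw∈ =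
    subst (_∈ _) (drop-length-++ x w) (∈-map⁺ (drop (length x)) (∈-filter⁺ (x ≼?_) xw∈ (≼-++ x w)))

  ∈-below⁻ : ∀ {x w vs} → w ∈ below x vs → x ++ w ∈ vs
  ∈-below⁻ {x} w∈ with ∈-map⁻ (drop (length x)) w∈
  ... | u , u∈ , refl with ∈-filter⁻ (x ≼?_) u∈
  ...   | u∈vs , (w , refl) = subst (λ w′ → x ++ w′ ∈ _) (sym (drop-length-++ x w)) u∈vs

  subtree : (Γ : TreeTopology P) (x : Word) → x ∈ V Γ → TreeTopology P
  subtree Γ x x∈ = record
    { V            = below x (V Γ)
    ; root∈        = ∈-below⁺ (subst (_∈ V Γ) (sym (++-identityʳ x)) x∈)
    ; prefixClosed = λ u w uw∈ →
        ∈-below⁺ (prefixClosed Γ (x ++ u) w (subst (_∈ V Γ) (sym (++-assoc x u w)) (∈-below⁻ uw∈)))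
    }

  ∈-subtree : ∀ {Γ x x∈ w} → w ∈ V (subtree Γ x x∈) ⇔ x ++ w ∈ V Γ
  ∈-subtree = mk⇔ ∈-below⁻ ∈-below⁺

  outside : Word → List Word → List Word
  outside x vs = filter (∁? (x ≼?_)) vs

  prune : (Γ : TreeTopology P) (d : Word) → d ≢ [] → TreeTopology P
  prune Γ d d≢[] = record
    { V            = outside d (V Γ)
    ; root∈        = ∈-filter⁺ (∁? (d ≼?_)) (root∈ Γ) (d≢[] ∘ ≼[]⇒≡[])
    ; prefixClosed = λ u w uw∈ → let uw∈V , d⋠uw = ∈-filter⁻ (∁? (d ≼?_)) uw∈ in
        ∈-filter⁺ (∁? (d ≼?_)) (prefixClosed Γ u w uw∈V) (d⋠uw ∘ λ d≼u → ≼-trans d≼u (≼-++ u w))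
    }

  ∈-prune : ∀ {Γ d d≢[] u} → ¬ d ≼ u → u ∈ V Γ ⇔ u ∈ V (prune Γ d d≢[])
  ∈-prune d⋠u = mk⇔ (λ u∈ → ∈-filter⁺ (∁? (_ ≼?_)) u∈ d⋠u) (proj₁ ∘ ∈-filter⁻ (∁? (_ ≼?_)))

  graft : (Γ : TreeTopology P) (x : Word) → x ∈ V Γ → x ≢ [] → TreeTopology P → TreeTopology P
  graft Γ x x∈ x≢[] N = record
    { V            = V Γ′ ++ map (x ++_) (V N)
    ; root∈        = ∈-++⁺ˡ (root∈ Γ′)
    ; prefixClosed = closed
    }
    where
    Γ′ : TreeTopology P
    Γ′ = prune Γ x x≢[]
    closed : ∀ u w → u ++ w ∈ V Γ′ ++ map (x ++_) (V N) → u ∈ V Γ′ ++ map (x ++_) (V N)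
    closed u w uw∈ with ∈-++⁻ (V Γ′) uw∈
    ... | inj₁ uw∈Γ′ = ∈-++⁺ˡ (prefixClosed Γ′ u w uw∈Γ′)
    ... | inj₂ uw∈N with ∈-map⁻ (x ++_) uw∈N
    ...   | z , z∈ , uw≡xz with x ≼? u
    ...     | yes (t , refl) = ∈-++⁺ʳ (V Γ′) (∈-map⁺ (x ++_) (prefixClosed N t w tw∈N))
      where
      tw∈N : t ++ w ∈ V N
      tw∈N = subst (_∈ V N) (sym (++-cancelˡ x _ _ (trans (sym (++-assoc x t w)) uw≡xz))) z∈
    ...     | no x⋠u with ≼-comparable u w x z uw≡xz
    ...       | inj₁ (t , refl) = ∈-++⁺ˡ (to (∈-prune {Γ} {x} {x≢[]} x⋠u) (prefixClosed Γ u t x∈))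
    ...       | inj₂ x≼u        = contradiction x≼u x⋠u

  module _ {Γ N : TreeTopology P} {x : Word} {x∈ : x ∈ V Γ} {x≢[] : x ≢ []} where

    ∈-graft-outside : ∀ {u} → ¬ x ≼ u → u ∈ V Γ ⇔ u ∈ V (graft Γ x x∈ x≢[] N)
    ∈-graft-outside {u} x⋠u = mk⇔ (∈-++⁺ˡ ∘ to (∈-prune {Γ} {x} {x≢[]} x⋠u)) graft⊆Γ
      where
      graft⊆Γ : u ∈ V (graft Γ x x∈ x≢[] N) → u ∈ V Γ
      graft⊆Γ u∈ with ∈-++⁻ (V (prune Γ x x≢[])) u∈
      ... | inj₁ u∈Γ′ = from (∈-prune {Γ} {x} {x≢[]} x⋠u) u∈Γ′
      ... | inj₂ u∈N with w , _ , refl ← ∈-map⁻ (x ++_) u∈N = contradiction (≼-++ x w) x⋠u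

    ∈-graft-inside : ∀ {w} → x ++ w ∈ V (graft Γ x x∈ x≢[] N) ⇔ w ∈ V N
    ∈-graft-inside {w} = mk⇔ inside⁻ (∈-++⁺ʳ (V (prune Γ x x≢[])) ∘ ∈-map⁺ (x ++_))
      where
      inside⁻ : x ++ w ∈ V (graft Γ x x∈ x≢[] N) → w ∈ V N
      inside⁻ xw∈ with ∈-++⁻ (V (prune Γ x x≢[])) xw∈
      ... | inj₁ xw∈Γ′ = contradiction (≼-++ x w) (proj₂ (∈-filter⁻ (∁? (x ≼?_)) {xs = V Γ} xw∈Γ′))
      ... | inj₂ xw∈N with w′ , w′∈ , e ← ∈-map⁻ (x ++_) xw∈N =
        subst (_∈ V N) (sym (++-cancelˡ x w w′ e)) w′∈

  ∈-image : ∀ {φ : Word → Word} → (∀ u → φ (φ u) ≡ u) → ∀ {u vs} → u ∈ map φ vs ⇔ φ u ∈ vs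
  ∈-image {φ} inv {u} {vs} = mk⇔ image⁻ (λ φu∈ → subst (_∈ map φ vs) (inv u) (∈-map⁺ φ φu∈))
    where
    image⁻ : u ∈ map φ vs → φ u ∈ vs
    image⁻ u∈ with y , y∈ , refl ← ∈-map⁻ φ u∈ = subst (_∈ vs) (sym (inv y)) y∈

  image : (Γ : TreeTopology P) (φ : Word → Word) → (∀ u → φ (φ u) ≡ u) →
          (∀ u w → φ (u ++ w) ∈ V Γ → φ u ∈ V Γ) → TreeTopology P
  image Γ φ inv closed = record
    { V            = map φ (V Γ)
    ; root∈        = from (∈-image inv) (closed [] (φ []) (subst (_∈ V Γ) (sym (inv [])) (root∈ Γ)))
    ; prefixClosed = λ u w uw∈ → from (∈-image inv) (closed u w (to (∈-image inv) uw∈))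
    }

  size-subtree : ∀ {Γ x x∈} → x ≢ [] → size (subtree Γ x x∈) < size Γ
  size-subtree {Γ} {x} x≢[] =
    subst (_< size Γ) (sym (length-map (drop (length x)) (filter (x ≼?_) (V Γ))))
      (filter-notAll (x ≼?_) (V Γ) (lose (root∈ Γ) (x≢[] ∘ ≼[]⇒≡[])))

  size-prune : ∀ {Γ d d≢[]} → d ∈ V Γ → size (prune Γ d d≢[]) < size Γ
  size-prune {Γ} {d} d∈ = filter-notAll (∁? (d ≼?_)) (V Γ) (lose d∈ λ d⋠d → d⋠d (≼-refl d))

  size-graft-subtree : ∀ {Γ x z x∈ x≢[] z∈} → x ≼ z → length x < length z →
                       size (graft Γ x x∈ x≢[] (subtree Γ z z∈)) < size Γ
  size-graft-subtree {Γ} {x} {z} {x∈} x≼z x<z = begin-strict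
    length (outside x (V Γ) ++ map (x ++_) (below z (V Γ)))
      ≡⟨ length-++ (outside x (V Γ)) ⟩
    length (outside x (V Γ)) + length (map (x ++_) (below z (V Γ)))
      ≡⟨ cong (length (outside x (V Γ)) +_)
           (trans (length-map (x ++_) (below z (V Γ))) (length-map (drop (length z)) (filter (z ≼?_) (V Γ)))) ⟩
    length (outside x (V Γ)) + length (filter (z ≼?_) (V Γ))
      <⟨ ℕ.+-monoʳ-< (length (outside x (V Γ)))
           (length-filter-⊂ (z ≼?_) (x ≼?_) (≼-trans x≼z) (lose x∈ (≼-refl x , <⇒⋠ x<z))) ⟩
    length (outside x (V Γ)) + length (filter (x ≼?_) (V Γ))
      ≡⟨ length-filter-∁ (x ≼?_) (V Γ) ⟩
    size Γ ∎
    where open ℕ.≤-Reasoning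

  module _ {D : Word → Set} (D? : Decidable D) where

    count : TreeTopology P → ℕ
    count Γ = length (filter D? (V Γ))

    count-prune : ∀ {Γ d d≢[] u} → u ∈ V Γ → D u → d ≼ u → count (prune Γ d d≢[]) < count Γ
    count-prune {Γ} {d} u∈ Du d≼u =
      subst (_< count Γ) (sym (cong length (filter-filter D? (∁? (d ≼?_)) (V Γ))))
        (length-filter-⊂ (D? ∩? ∁? (d ≼?_)) D? proj₁ (lose u∈ (Du , λ (_ , d⋠u) → d⋠u d≼u)))

    count-graft : ∀ {Γ N x x∈ x≢[]} → (∀ {w} → w ∈ V N → ¬ D (x ++ w)) →
                  count (graft Γ x x∈ x≢[] N) ≡ count (prune Γ x x≢[])
    count-graft {Γ} {N} {x} {x∈} {x≢[]} shallow = begin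
      length (filter D? (V Γ′ ++ map (x ++_) (V N)))
        ≡⟨ cong length (filter-++ D? (V Γ′) _) ⟩
      length (filter D? (V Γ′) ++ filter D? (map (x ++_) (V N)))
        ≡⟨ cong (λ l → length (filter D? (V Γ′) ++ l)) (filter-none D? (All.tabulate none)) ⟩
      length (filter D? (V Γ′) ++ [])
        ≡⟨ cong length (++-identityʳ (filter D? (V Γ′))) ⟩
      count Γ′ ∎
      where
      open ≡-Reasoning
      Γ′ : TreeTopology P
      Γ′ = prune Γ x x≢[]
      none : ∀ {y} → y ∈ map (x ++_) (V N) → ¬ D y
      none y∈ with w , w∈ , refl ← ∈-map⁻ (x ++_) y∈ = shallow w∈

  Run : TreeTopology P → Labelling P → Labelling P → Set
  Run Γ = Star (Step P Γ)

  data Hears (Γ : TreeTopology P) (v u : Word) : Action nΣ → Set where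
    hears : ∀ {m} → u ∈ V Γ → Adj P v u → Hears Γ v u (bcast m)

  hears? : ∀ Γ v u α → Dec (Hears Γ v u α)
  hears? Γ v u (bcast m) =
    map′ (λ (u∈ , adj) → hears u∈ adj) (λ { (hears u∈ adj) → u∈ , adj }) ((u ∈? V Γ) ×-dec Adj? v u)
  hears? Γ v u (recv m)  = no λ ()
  hears? Γ v u tau       = no λ ()

  hears-adj : ∀ {Γ v u α} → Hears Γ v u α → Adj P v u
  hears-adj (hears _ adj) = adj

  hears-transfer : ∀ {Γ Γ′ v u α} → (u ∈ V Γ → u ∈ V Γ′) → Hears Γ v u α → Hears Γ′ v u α
  hears-transfer mem (hears u∈ adj) = hears (mem u∈) adj

  -- Only broadcasts are heard.
  Reaction : Action nΣ → Fin nQ → Fin nQ → Set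
  Reaction (bcast m) q q′ = (q , recv m , q′) ∈ Δ ⊎ (¬ InR P q m × q′ ≡ q)
  Reaction _         _ _  = ⊥

  Effect : TreeTopology P → Word → Action nΣ → Labelling P → Labelling P → Set
  Effect Γ v α L L′ =
    ∀ u → u ≢ v → (Hears Γ v u α → Reaction α (L u) (L′ u)) × (¬ Hears Γ v u α → L′ u ≡ L u)

  module _ {Γ : TreeTopology P} {L L′ : Labelling P} where

    actor : Step P Γ L L′ → Word
    actor = proj₁

    action : Step P Γ L L′ → Action nΣ
    action s = proj₁ (proj₂ (proj₂ s))

    actor∈ : (s : Step P Γ L L′) → actor s ∈ V Γ
    actor∈ (_ , _ , _ , _ , v∈ , _) = v∈

    transition : (s : Step P Γ L L′) → (L (actor s) , action s , L′ (actor s)) ∈ Δ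
    transition (_ , _ , _ , _ , _ , t , refl , refl , _) = t

    effect : (s : Step P Γ L L′) → Effect Γ (actor s) (action s) L L′
    effect (_ , _ , tau     , _ , _ , _ , _ , _ , eff) u u≢v = (λ ()) , λ _ → eff u u≢v
    effect (_ , _ , bcast m , _ , _ , _ , _ , _ , eff) u u≢v =
      (λ { (hears u∈ adj) → proj₁ (eff u u≢v) (u∈ , adj) }) ,
      λ ¬h → proj₂ (eff u u≢v) λ (u∈ , adj) → ¬h (hears u∈ adj)

    step-unheard : (s : Step P Γ L L′) → ∀ {u} → u ≢ actor s → ¬ Hears Γ (actor s) u (action s) → L′ u ≡ L u
    step-unheard s {u} u≢v = proj₂ (effect s u u≢v)

    step-elsewhere : (s : Step P Γ L L′) → ∀ {u} → u ≢ actor s → L′ u ≡ L u ⊎ ∃[ m ] ((L u , recv m , L′ u) ∈ Δ)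
    step-elsewhere s {u} u≢v with hears? Γ (actor s) u (action s)
    ... | no ¬h = inj₁ (step-unheard s u≢v ¬h)
    ... | yes h@(hears {m} _ _) with proj₁ (effect s u u≢v) h
    ...   | inj₁ t       = inj₂ (m , t)
    ...   | inj₂ (_ , e) = inj₁ e

    reenact : ∀ {Γ′ K K′ v} (s : Step P Γ L L′) → v ∈ V Γ′ → K v ≡ L (actor s) → K′ v ≡ L′ (actor s) →
              Effect Γ′ v (action s) K K′ → Step P Γ′ K K′
    reenact (_ , q , tau , q′ , _ , t , e₁ , e₂ , _) v∈ e₁′ e₂′ eff′ =
      _ , q , tau , q′ , v∈ , t , trans e₁′ e₁ , trans e₂′ e₂ , λ u u≢v → proj₂ (eff′ u u≢v) λ ()
    reenact (_ , q , bcast m , q′ , _ , t , e₁ , e₂ , _) v∈ e₁′ e₂′ eff′ =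
      _ , q , bcast m , q′ , v∈ , t , trans e₁′ e₁ , trans e₂′ e₂ ,
      λ u u≢v → (λ (u∈ , adj) → proj₁ (eff′ u u≢v) (hears u∈ adj)) ,
                λ ¬n → proj₂ (eff′ u u≢v) λ { (hears u∈ adj) → ¬n (u∈ , adj) }

  pullback : ∀ {Γ Γ′ L L′ K} (ι : Word → Word) → (∀ {a c} → ι a ≡ ι c → a ≡ c) →
             (∀ {w} → w ∈ V Γ′ ⇔ ι w ∈ V Γ) → (∀ {a c} → Adj P a c ⇔ Adj P (ι a) (ι c)) →
             (s : Step P Γ L L′) → ∀ {w₀} → actor s ≡ ι w₀ → (∀ w → K w ≡ L (ι w)) → Step P Γ′ K (L′ ∘ ι)
  pullback {Γ} {Γ′} {L} {L′} {K} ι inj mem adj s@(_ , _) {w₀} refl K≗ =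
    reenact s (from mem (actor∈ s)) (K≗ w₀) refl eff′
    where
    eff′ : Effect Γ′ w₀ (action s) K (L′ ∘ ι)
    eff′ w w≢w₀ with heard , unheard ← effect s (ι w) (w≢w₀ ∘ inj) =
      (λ h → subst (λ q → Reaction (action s) q (L′ (ι w))) (sym (K≗ w)) (heard (push h))) ,
      λ ¬h → trans (unheard (¬h ∘ pull)) (sym (K≗ w))
      where
      push : ∀ {α} → Hears Γ′ w₀ w α → Hears Γ (ι w₀) (ι w) α
      push (hears w∈ a) = hears (to mem w∈) (to adj a)
      pull : ∀ {α} → Hears Γ (ι w₀) (ι w) α → Hears Γ′ w₀ w α
      pull (hears w∈ a) = hears (from mem w∈) (from adj a)

  receives? : ∀ q m → Dec (InR P q m)
  receives? q m = map′ from-any (λ (q′ , t∈) → lose t∈ (q′ , refl)) (any? is-reception? Δ)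
    where
    IsReception : Fin nQ × Action nΣ × Fin nQ → Set
    IsReception t = ∃[ q′ ] (t ≡ (q , recv m , q′))
    from-any : Any IsReception Δ → InR P q m
    from-any any with _ , t∈ , q′ , refl ← find any = q′ , t∈
    is-reception? : ∀ t → Dec (IsReception t)
    is-reception? (p , tau      , q′) = no λ { (_ , ()) }
    is-reception? (p , bcast _  , q′) = no λ { (_ , ()) }
    is-reception? (p , recv m′ , q′) with p Fin.≟ q | m′ Fin.≟ m
    ... | yes refl | yes refl = yes (q′ , refl)
    ... | no p≢q   | _        = no λ (_ , e) → p≢q (cong proj₁ e)
    ... | _        | no m′≢m  = no λ { (_ , refl) → m′≢m refl }

  react : Fin nQ → Fin nΣ → Fin nQ
  react q m with receives? q m
  ... | yes (q′ , _) = q′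
  ... | no _         = q

  react-reaction : ∀ q m → Reaction (bcast m) q (react q m)
  react-reaction q m with receives? q m
  ... | yes (_ , t) = inj₁ t
  ... | no ¬r       = inj₂ (¬r , refl)

  respond : TreeTopology P → Word → Action nΣ → Labelling P → Labelling P
  respond Γ v α K u with hears? Γ v u α
  ... | yes (hears {m} _ _) = react (K u) m
  ... | no _                = K u

  module _ {Γ : TreeTopology P} {v u : Word} {α : Action nΣ} {K : Labelling P} where

    respond-heard : Hears Γ v u α → Reaction α (K u) (respond Γ v α K u)
    respond-heard h with hears? Γ v u α
    ... | yes (hears {m} _ _) = react-reaction (K u) m
    ... | no ¬h               = contradiction h ¬h

    respond-unheard : ¬ Hears Γ v u α → respond Γ v α K u ≡ K u
    respond-unheard ¬h with hears? Γ v u α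
    ... | yes h = contradiction h ¬h
    ... | no _  = refl

  select : {A : Word → Set} → Decidable A → Labelling P → Labelling P → Labelling P
  select A? L K u with A? u
  ... | yes _ = L u
  ... | no _  = K u

  module _ {A : Word → Set} (A? : Decidable A) {L K : Labelling P} where

    select-in : ∀ {u} → A u → select A? L K u ≡ L u
    select-in {u} Au with A? u
    ... | yes _  = refl
    ... | no ¬Au = contradiction Au ¬Au

    select-out : ∀ {u} → ¬ A u → select A? L K u ≡ K u
    select-out {u} ¬Au with A? u
    ... | yes Au = contradiction Au ¬Au
    ... | no _   = refl

  replay : ∀ {Γ Γ′ L L′ K} {A : Word → Set} (A? : Decidable A) (s : Step P Γ L L′) → A (actor s) →
           (∀ {u} → A u → u ∈ V Γ ⇔ u ∈ V Γ′) → (∀ {u} → A u → K u ≡ L u) →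
           ∃[ K′ ] (Step P Γ′ K K′ × (∀ {u} → A u → K′ u ≡ L′ u)
                    × (∀ {u} → ¬ A u → ¬ Hears Γ′ (actor s) u (action s) → K′ u ≡ K u))
  replay {Γ} {Γ′} {L} {L′} {K} A? s Av mem agree =
    K′ , reenact s (to (mem Av) (actor∈ s)) (agree Av) (select-in A? Av) eff′ ,
    select-in A? , λ ¬Au ¬h → trans (select-out A? ¬Au) (respond-unheard ¬h)
    where
    K′ : Labelling P
    K′ = select A? L′ (respond Γ′ (actor s) (action s) K)
    eff′ : Effect Γ′ (actor s) (action s) K K′
    eff′ u u≢v with A? u | effect s u u≢v
    ... | yes Au | heard , unheard =
      (λ h → subst (λ q → Reaction (action s) q (L′ u)) (sym (agree Au)) (heard (hears-transfer (from (mem Au)) h))) ,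
      λ ¬h → trans (unheard (¬h ∘ hears-transfer (to (mem Au)))) (sym (agree Au))
    ... | no _   | _ = respond-heard , respond-unheard

  module _ {Γ : TreeTopology P} (φ : Word → Word) (inv : ∀ u → φ (φ u) ≡ u)
           (closed : ∀ u w → φ (u ++ w) ∈ V Γ → φ u ∈ V Γ) where

    relabel : (∀ {a c} → Adj P a c → Adj P (φ a) (φ c)) →
              ∀ {L L′} → Run Γ L L′ → Run (image Γ φ inv closed) (L ∘ φ) (L′ ∘ φ)
    relabel adj = gmap (_∘ φ) λ s →
      pullback φ injective (∈-image inv) (mk⇔ adj adj⁻) s (sym (inv (actor s))) (λ _ → refl)
      where
      injective : ∀ {a c} → φ a ≡ φ c → a ≡ c
      injective {a} {c} e = trans (sym (inv a)) (trans (cong φ e) (inv c))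
      adj⁻ : ∀ {a c} → Adj P (φ a) (φ c) → Adj P a c
      adj⁻ {a} {c} = subst₂ (Adj P) (inv a) (inv c) ∘ adj

  -- Re-rooting at the child [ k ] of the root: swapRoot k exchanges the children [ 0 ] and [ k ],
  -- then rotate makes [ 0 ] the root.
  swap₀ : ℕ → ℕ → ℕ
  swap₀ k zero    = k
  swap₀ k (suc i) with suc i ℕ.≟ k
  ... | yes _ = zero
  ... | no _  = suc i

  swap₀-involutive : ∀ k i → swap₀ k (swap₀ k i) ≡ i
  swap₀-involutive zero    zero = refl
  swap₀-involutive (suc k) zero with suc k ℕ.≟ suc k
  ... | yes _   = refl
  ... | no k≢k  = contradiction refl k≢k
  swap₀-involutive k (suc i) with suc i ℕ.≟ k
  ... | yes refl = refl
  ... | no i≢k with suc i ℕ.≟ k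
  ...   | yes i≡k = contradiction i≡k i≢k
  ...   | no _    = refl

  swapRoot : ℕ → Word → Word
  swapRoot k []      = []
  swapRoot k (i ∷ w) = swap₀ k i ∷ w

  swapRoot-involutive : ∀ k u → swapRoot k (swapRoot k u) ≡ u
  swapRoot-involutive k []      = refl
  swapRoot-involutive k (i ∷ w) = cong (_∷ w) (swap₀-involutive k i)

  swapRoot-closed : ∀ (Γ : TreeTopology P) k u w → swapRoot k (u ++ w) ∈ V Γ → swapRoot k u ∈ V Γ
  swapRoot-closed Γ k []      w _   = root∈ Γ
  swapRoot-closed Γ k (i ∷ u) w uw∈ = prefixClosed Γ (swap₀ k i ∷ u) w uw∈

  swapRoot-child : ∀ k {a c} → ∃[ l ] (a ≡ c ++ [ l ]) → ∃[ l ] (swapRoot k a ≡ swapRoot k c ++ [ l ])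
  swapRoot-child k {c = []}    (l , refl) = swap₀ k l , refl
  swapRoot-child k {c = i ∷ c} (l , refl) = l , refl

  swapRoot-Adj : ∀ k {a c} → Adj P a c → Adj P (swapRoot k a) (swapRoot k c)
  swapRoot-Adj k (inj₁ child) = inj₁ (swapRoot-child k child)
  swapRoot-Adj k (inj₂ child) = inj₂ (swapRoot-child k child)

  rotate : Word → Word
  rotate []             = [ 0 ]
  rotate (zero ∷ [])    = []
  rotate (zero ∷ j ∷ w) = suc j ∷ w
  rotate (suc i ∷ w)    = zero ∷ i ∷ w

  rotate-involutive : ∀ u → rotate (rotate u) ≡ u
  rotate-involutive []             = refl
  rotate-involutive (zero ∷ [])    = refl
  rotate-involutive (zero ∷ j ∷ w) = refl
  rotate-involutive (suc i ∷ w)    = refl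

  rotate-closed : ∀ (Γ : TreeTopology P) → [ 0 ] ∈ V Γ → ∀ u w → rotate (u ++ w) ∈ V Γ → rotate u ∈ V Γ
  rotate-closed Γ 0∈ []             w _   = 0∈
  rotate-closed Γ 0∈ (zero ∷ [])    w _   = root∈ Γ
  rotate-closed Γ 0∈ (zero ∷ j ∷ u) w uw∈ = prefixClosed Γ (suc j ∷ u) w uw∈
  rotate-closed Γ 0∈ (suc i ∷ u)    w uw∈ = prefixClosed Γ (zero ∷ i ∷ u) w uw∈

  rotate-child : ∀ {a c} → ∃[ l ] (a ≡ c ++ [ l ]) → Adj P (rotate a) (rotate c)
  rotate-child {c = []}             (zero  , refl) = inj₂ (0 , refl)
  rotate-child {c = []}             (suc i , refl) = inj₁ (i , refl)
  rotate-child {c = zero ∷ []}      (l , refl)     = inj₁ (suc l , refl)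
  rotate-child {c = zero ∷ j ∷ c}   (l , refl)     = inj₁ (l , refl)
  rotate-child {c = suc i ∷ c}      (l , refl)     = inj₁ (l , refl)

  rotate-Adj : ∀ {a c} → Adj P a c → Adj P (rotate a) (rotate c)
  rotate-Adj (inj₁ child) = rotate-child child
  rotate-Adj (inj₂ child) = Adj-sym (rotate-child child)

  child-to-root : ∀ {Γ L} k w → (k ∷ w) ∈ V Γ → Run Γ (initial P) L →
                  ∃[ Γ′ ] (rotate (0 ∷ w) ∈ V Γ′ × Run Γ′ (initial P) (L ∘ swapRoot k ∘ rotate))
  child-to-root {Γ} {L} k w kw∈ E = Γ₂ , rotated∈ , relabel rotate rotate-involutive rotated-closed rotate-Adj E₁
    where
    Γ₁ : TreeTopology P
    Γ₁ = image Γ (swapRoot k) (swapRoot-involutive k) (swapRoot-closed Γ k)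
    E₁ : Run Γ₁ (initial P) (L ∘ swapRoot k)
    E₁ = relabel (swapRoot k) (swapRoot-involutive k) (swapRoot-closed Γ k) (swapRoot-Adj k) E
    0w∈ : (0 ∷ w) ∈ V Γ₁
    0w∈ = from (∈-image (swapRoot-involutive k)) kw∈
    rotated-closed : ∀ u w → rotate (u ++ w) ∈ V Γ₁ → rotate u ∈ V Γ₁
    rotated-closed = rotate-closed Γ₁ (prefixClosed Γ₁ [ 0 ] w 0w∈)
    Γ₂ : TreeTopology P
    Γ₂ = image Γ₁ rotate rotate-involutive rotated-closed
    rotated∈ : rotate (0 ∷ w) ∈ V Γ₂
    rotated∈ = from (∈-image rotate-involutive) (subst (_∈ V Γ₁) (sym (rotate-involutive (0 ∷ w))) 0w∈)

  RootReachable : TreeTopology P → Fin nQ → Set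
  RootReachable Γ p = ∃[ K ] (Run Γ (initial P) K × K [] ≡ p)

  reroot-child : ∀ {Γ L} k w → (k ∷ w) ∈ V Γ → Run Γ (initial P) L → ∃[ Γ′ ] RootReachable Γ′ (L (k ∷ w))
  reroot-child k []      k∈  E with Γ′ , _ , E′ ← child-to-root k [] k∈ E = Γ′ , _ , E′ , refl
  reroot-child k (j ∷ w) kw∈ E with Γ′ , jw∈ , E′ ← child-to-root k (j ∷ w) kw∈ E =
    reroot-child (suc j) w jw∈ E′

  reroot : ∀ {Γ L v} → v ∈ V Γ → Run Γ (initial P) L → ∃[ Γ′ ] RootReachable Γ′ (L v)
  reroot {Γ} {v = []}    _   E = Γ , _ , E , refl
  reroot {v = k ∷ w} kw∈ E = reroot-child k w kw∈ E

  module _ (tpb : TwoPhaseBounded P) where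

    part : Fin nQ → Part
    part = proj₁ tpb

    allowed : ∀ {q α q′} → (q , α , q′) ∈ Δ → Allowed (part q) α (part q′)
    allowed {q} {α} {q′} = proj₂ (proj₂ tpb) q α q′

    -- Silent: the process has not broadcast yet. Retired: it will never broadcast again.
    Silent : Fin nQ → Set
    Silent q = Quiet (part q)

    silent? : ∀ q → Dec (Silent q)
    silent? q = quiet? (part q)

    Retired : Fin nQ → Set
    Retired q = part q ≡ p2r

    silent-initial : ∀ u → Silent (initial P u)
    silent-initial _ = subst Quiet (sym (proj₁ (proj₂ tpb))) quiet₀

    retired⇒¬silent : ∀ {q} → Retired q → ¬ Silent q
    retired⇒¬silent ret sil with () ← subst Quiet ret sil

    ¬silent-stable : ∀ {q α q′} → (q , α , q′) ∈ Δ → ¬ Silent q → ¬ Silent q′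
    ¬silent-stable {α = tau}     t ¬sil = ¬sil ∘ subst Quiet (sym (tau-stays (allowed t)))
    ¬silent-stable {α = bcast m} t ¬sil = bcast-¬quiet (allowed t)
    ¬silent-stable {α = recv m}  t ¬sil = retired⇒¬silent (recv-¬quiet (allowed t) ¬sil)

    retired-stable : ∀ {q α q′} → (q , α , q′) ∈ Δ → Retired q → Retired q′
    retired-stable {α = tau}     t ret = trans (sym (tau-stays (allowed t))) ret
    retired-stable {α = bcast m} t ret = contradiction ret (bcast-not-p2r (allowed t))
    retired-stable {α = recv m}  t ret = recv-¬quiet (allowed t) (retired⇒¬silent ret)

    silent-mute : ∀ {q α q′ Γ v u} → (q , α , q′) ∈ Δ → Silent q′ → ¬ Hears Γ v u α
    silent-mute t sil (hears _ _) = bcast-¬quiet (allowed t) sil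

    retired-mute : ∀ {q α q′ Γ v u} → (q , α , q′) ∈ Δ → Retired q → ¬ Hears Γ v u α
    retired-mute t ret (hears _ _) = bcast-not-p2r (allowed t) ret

    module _ {Γ : TreeTopology P} {L L′ : Labelling P} (s : Step P Γ L L′) where

      step-preserves : ∀ {Q : Fin nQ → Set} → (∀ {q α q′} → (q , α , q′) ∈ Δ → Q q → Q q′) →
                       ∀ u → Q (L u) → Q (L′ u)
      step-preserves {Q} stable u Qu with u ≟ʷ actor s
      ... | yes refl = stable (transition s) Qu
      ... | no u≢v with step-elsewhere s u≢v
      ...   | inj₁ e       = subst Q (sym e) Qu
      ...   | inj₂ (_ , t) = stable t Qu

      step-¬silent : ∀ u → ¬ Silent (L u) → ¬ Silent (L′ u)
      step-¬silent = step-preserves ¬silent-stable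

      step-retired : ∀ u → Retired (L u) → Retired (L′ u)
      step-retired = step-preserves retired-stable

      step-silent⁻ : ∀ u → Silent (L′ u) → Silent (L u)
      step-silent⁻ u sil with silent? (L u)
      ... | yes sil₀ = sil₀
      ... | no ¬sil₀ = contradiction sil (step-¬silent u ¬sil₀)

      ¬silent-elsewhere : ∀ {u} → u ≢ actor s → ¬ Silent (L u) → L′ u ≡ L u ⊎ Retired (L′ u)
      ¬silent-elsewhere u≢v ¬sil with step-elsewhere s u≢v
      ... | inj₁ e       = inj₁ e
      ... | inj₂ (_ , t) = inj₂ (recv-¬quiet (allowed t) ¬sil)

      silent-stays : ∀ {u} → u ≢ actor s → Silent (L u) → Silent (L′ u)
      silent-stays u≢v sil with step-elsewhere s u≢v
      ... | inj₁ e       = subst Quiet (cong part (sym e)) sil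
      ... | inj₂ (_ , t) = recv-quiet (allowed t) sil

    run-¬silent : ∀ {Γ L L′} → Run Γ L L′ → ∀ u → ¬ Silent (L u) → ¬ Silent (L′ u)
    run-¬silent ε        u ¬sil = ¬sil
    run-¬silent (s ◅ ss) u ¬sil = run-¬silent ss u (step-¬silent s u ¬sil)

    SilentAt : Word → Labelling P → Set
    SilentAt u L = Silent (L u)

    module Projection {Γ : TreeTopology P} {x y : Word} {j : ℕ} (x≡yj : x ≡ y ++ [ j ]) (x∈ : x ∈ V Γ) where

      Restricts : Labelling P → Labelling P → Set
      Restricts K L = ∀ w → K w ≡ L (x ++ w)

      project-step : ∀ {K L L′} → Restricts K L → Within (Step P Γ) (SilentAt y) L L′ →
                     ∃[ K′ ] (Run (subtree Γ x x∈) K K′ × Restricts K′ L′)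
      project-step {K} {L} {L′} K≗L (_ , s , y-silent) with x ≼? actor s
      ... | yes (w₀ , v≡xw₀) =
        L′ ∘ (x ++_) ,
        pullback (x ++_) (++-cancelˡ x _ _) (∈-subtree {Γ} {x} {x∈}) (mk⇔ (Adj-++ x) (Adj-++⁻ x)) s v≡xw₀ K≗L ◅ ε ,
        λ _ → refl
      ... | no x⋠v = K , ε , λ w → trans (K≗L w) (sym (step-unheard s (x⋠v ∘ (w ,_) ∘ sym) (unheard w)))
        where
        unheard : ∀ w → ¬ Hears Γ (actor s) (x ++ w) (action s)
        unheard w h with _ , v≡y ← subtree-boundary x≡yj (≼-++ x w) x⋠v (hears-adj h) =
          silent-mute (transition s) (subst (λ v → Silent (L′ v)) (sym v≡y) y-silent) h

      project : ∀ {L} → Run Γ (initial P) L → Silent (L y) → RootReachable (subtree Γ x x∈) (L x)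
      project {L} E y-silent =
        let K , E′ , K≗L = simulate Restricts project-step (λ _ → refl)
                             (proj₂ (within-backward (λ s → step-silent⁻ s y) E y-silent))
        in K , E′ , trans (K≗L []) (cong L (++-identityʳ x))

    module Desync {Γ Γ′ : TreeTopology P} {A : Word → Set} (A? : Decidable A) {z : Word} (z∈A : A z)
                  (mem : ∀ {u} → A u → u ∈ V Γ ⇔ u ∈ V Γ′) where

      -- K follows L on A, except that z may fall behind once it has retired: a retired vertex never
      -- broadcasts, so its state no longer matters to the others.
      Agrees : Labelling P → Labelling P → Set
      Agrees K L = (∀ {u} → A u → u ≢ z → K u ≡ L u) × (K z ≡ L z ⊎ Retired (L z))

      agree-synced : ∀ {K L : Labelling P} → (∀ {u} → A u → u ≢ z → K u ≡ L u) → K z ≡ L z →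
                     ∀ {u} → A u → K u ≡ L u
      agree-synced agree z-synced {u} Au with u ≟ʷ z
      ... | yes refl = z-synced
      ... | no u≢z   = agree Au u≢z

      Confined : ∀ {L L′} → Step P Γ L L′ → Set
      Confined {L} s = ¬ A (actor s) → ∀ {u} → A u → Hears Γ (actor s) u (action s) → u ≡ z × ¬ Silent (L z)

      desync-step : ∀ {K L L′} → Agrees K L → (s : Step P Γ L L′) → Confined s →
                    ∃[ K′ ] (Run Γ′ K K′ × Agrees K′ L′)
      desync-step {K} {L} {L′} (agree , z-status) s leak with A? (actor s) | z-status
      ... | yes Av | inj₁ z-synced
        with K′ , s′ , synced , _ ← replay A? s Av mem (agree-synced agree z-synced) =
        K′ , s′ ◅ ε , (λ Au _ → synced Au) , inj₁ (synced z∈A)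
      ... | yes Av | inj₂ z-retired with actor s ≟ʷ z
      ...   | yes refl =
        K , ε , (λ Au u≢z → trans (agree Au u≢z) (sym (step-unheard s u≢z (retired-mute (transition s) z-retired)))) ,
        inj₂ (step-retired s z z-retired)
      ...   | no v≢z
        with K′ , s′ , synced , _ ←
               replay (A? ∩? λ u → ¬? (u ≟ʷ z)) s (Av , v≢z) (mem ∘ proj₁) (λ (Au , u≢z) → agree Au u≢z) =
        K′ , s′ ◅ ε , (λ Au u≢z → synced (Au , u≢z)) , inj₂ (step-retired s z z-retired)
      desync-step {K} {L} {L′} (agree , z-status) s leak | no ¬Av | _ =
        K , ε , (λ Au u≢z → trans (agree Au u≢z) (sym (step-unheard s (≢actor Au) (u≢z ∘ proj₁ ∘ leak ¬Av Au)))) ,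
        z-status′ z-status
        where
        ≢actor : ∀ {u} → A u → u ≢ actor s
        ≢actor Au refl = ¬Av Au
        z-status′ : K z ≡ L z ⊎ Retired (L z) → K z ≡ L′ z ⊎ Retired (L′ z)
        z-status′ (inj₂ z-retired) = inj₂ (step-retired s z z-retired)
        z-status′ (inj₁ z-synced) with hears? Γ (actor s) z (action s)
        ... | no ¬h = inj₁ (trans z-synced (sym (step-unheard s (≢actor z∈A) ¬h)))
        ... | yes h with ¬silent-elsewhere s (≢actor z∈A) (proj₂ (leak ¬Av z∈A h))
        ...   | inj₁ e         = inj₁ (trans z-synced (sym e))
        ...   | inj₂ z-retired = inj₂ z-retired

    module Pruning {Γ : TreeTopology P} {c d : Word} {j : ℕ} (d≡cj : d ≡ c ++ [ j ]) where

      d≢[] : d ≢ []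
      d≢[] = child≢[] d≡cj

      c-outside : ¬ d ≼ c
      c-outside = ∷ʳ-⋠ c j ∘ subst (_≼ c) d≡cj

      open Desync {Γ} {prune Γ d d≢[]} (∁? (d ≼?_)) c-outside (∈-prune {Γ} {d} {d≢[]})

      prune-step : ∀ {K L L′} → Agrees K L → (s : Step P Γ L L′) → ¬ Silent (L c) ⊎ Silent (L′ d) →
                   ∃[ K′ ] (Run (prune Γ d d≢[]) K K′ × Agrees K′ L′)
      prune-step {L = L} {L′} agrees s safe = desync-step agrees s (leak safe)
        where
        leak : ¬ Silent (L c) ⊎ Silent (L′ d) → Confined s
        leak safe ¬d⋠v d⋠u h
          with subtree-boundary d≡cj (decidable-stable (d ≼? actor s) ¬d⋠v) d⋠u (Adj-sym (hears-adj h)) | safe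
        ... | _ , u≡c   | inj₁ c-spoken = u≡c , c-spoken
        ... | v≡d , _   | inj₂ d-silent =
          contradiction h (silent-mute (transition s) (subst (λ v → Silent (L′ v)) (sym v≡d) d-silent))

      prune-run : ∀ {L₁ L} → Run Γ (initial P) L₁ → ¬ Silent (L₁ c) → Silent (L₁ d) → Run Γ L₁ L →
                  ∃[ K ] (Run (prune Γ d d≢[]) (initial P) K × ∀ {u} → ¬ d ≼ u → u ≢ c → K u ≡ L u)
      prune-run E₁ c-spoken d-silent E₂ =
        let K₁ , E₁′ , agrees₁ = simulate Agrees (λ ag (_ , s , d-silent′) → prune-step ag s (inj₂ d-silent′))
                                   ((λ _ _ → refl) , inj₁ refl)
                                   (proj₂ (within-backward (λ s → step-silent⁻ s d) E₁ d-silent))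
            K , E₂′ , agrees   = simulate Agrees (λ ag (c-spoken′ , s , _) → prune-step ag s (inj₁ c-spoken′))
                                   agrees₁ (within-forward (λ s → step-¬silent s c) E₂ c-spoken)
        in K , E₁′ ◅◅ E₂′ , proj₁ agrees

    data BreaksSilence (Γ : TreeTopology P) (x : Word) : Labelling P → Labelling P → Set where
      idle   : ∀ {L} → BreaksSilence Γ x L L
      breaks : ∀ {L₁ L₂ L} → Step P Γ L₁ L₂ → ¬ Silent (L₂ x) → Run Γ L₂ L → BreaksSilence Γ x L₁ L

    module Grafting {Γ N : TreeTopology P} {x y : Word} {j : ℕ} (x≡yj : x ≡ y ++ [ j ]) (x∈ : x ∈ V Γ) where

      x≢[] : x ≢ []
      x≢[] = child≢[] x≡yj

      Γ′ : TreeTopology P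
      Γ′ = graft Γ x x∈ x≢[] N

      ∈-inside : ∀ {w} → x ++ w ∈ V Γ′ ⇔ w ∈ V N
      ∈-inside = ∈-graft-inside {Γ} {N} {x} {x∈} {x≢[]}

      ∈-outside : ∀ {u} → ¬ x ≼ u → u ∈ V Γ ⇔ u ∈ V Γ′
      ∈-outside = ∈-graft-outside {Γ} {N} {x} {x∈} {x≢[]}

      Lifts : Labelling P → Labelling P → Set
      Lifts K M = (∀ w → K (x ++ w) ≡ M w) × (∀ {u} → ¬ x ≼ u → K u ≡ qin)

      lift-step : ∀ {K M M′} → Lifts K M → Within (Step P N) (SilentAt []) M M′ →
                  ∃[ K′ ] (Run Γ′ K K′ × Lifts K′ M′)
      lift-step {K} {M} {M′} (inside , outside) (_ , s , root-silent) =
        K′ , reenact s (from ∈-inside (actor∈ s)) (inside (actor s)) (lifted (actor s)) effect′ ◅ ε ,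
        lifted , λ x⋠u → trans (select-out (x ≼?_) x⋠u) (outside x⋠u)
        where
        K′ : Labelling P
        K′ = select (x ≼?_) (M′ ∘ drop (length x)) K
        lifted : ∀ w → K′ (x ++ w) ≡ M′ w
        lifted w = trans (select-in (x ≼?_) (≼-++ x w)) (cong M′ (drop-length-++ x w))
        push : ∀ {w α} → Hears N (actor s) w α → Hears Γ′ (x ++ actor s) (x ++ w) α
        push (hears w∈ adj) = hears (from ∈-inside w∈) (Adj-++ x adj)
        pull : ∀ {w α} → Hears Γ′ (x ++ actor s) (x ++ w) α → Hears N (actor s) w α
        pull (hears w∈ adj) = hears (to ∈-inside w∈) (Adj-++⁻ x adj)
        effect′ : Effect Γ′ (x ++ actor s) (action s) K K′
        effect′ u u≢v with x ≼? u
        ... | yes (w , refl) with heard , unheard ← effect s w (u≢v ∘ cong (x ++_)) =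
          (λ h → subst₂ (Reaction (action s)) (sym (inside w)) (sym (cong M′ (drop-length-++ x w))) (heard (pull h))) ,
          λ ¬h → trans (cong M′ (drop-length-++ x w)) (trans (unheard (¬h ∘ push)) (sym (inside w)))
        ... | no x⋠u = ⊥-elim ∘ unheard-outside , λ _ → refl
          where
          unheard-outside : ¬ Hears Γ′ (x ++ actor s) u (action s)
          unheard-outside h with xv≡x , _ ← subtree-boundary x≡yj (≼-++ x (actor s)) x⋠u (Adj-sym (hears-adj h)) =
            silent-mute (transition s) (subst (λ v → Silent (M′ v)) (sym v≡[]) root-silent) h
            where
            v≡[] : actor s ≡ []
            v≡[] = ++-cancelˡ x _ [] (trans xv≡x (sym (++-identityʳ x)))

      Frozen : Fin nQ → Labelling P → Labelling P → Set
      Frozen p K L = (∀ {u} → ¬ x ≼ u → K u ≡ L u) × K x ≡ p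

      freeze-step : ∀ {p K L L′} → Frozen p K L → Within (Step P Γ) (λ L → Silent (L y) × Silent (L x)) L L′ →
                    ∃[ K′ ] (Run Γ′ K K′ × Frozen p K′ L′)
      freeze-step {p} {K} {L} {L′} (agree , frozen) (_ , s , y-silent , x-silent) with x ≼? actor s
      ... | yes x≼v =
        K , ε , (λ x⋠u → trans (agree x⋠u) (sym (step-unheard s (λ { refl → x⋠u x≼v }) (unheard x⋠u)))) , frozen
        where
        unheard : ∀ {u} → ¬ x ≼ u → ¬ Hears Γ (actor s) u (action s)
        unheard x⋠u h with v≡x , _ ← subtree-boundary x≡yj x≼v x⋠u (Adj-sym (hears-adj h)) =
          silent-mute (transition s) (subst (λ v → Silent (L′ v)) (sym v≡x) x-silent) h
      ... | no x⋠v with K′ , s′ , synced , untouched ← replay (∁? (x ≼?_)) s x⋠v ∈-outside agree =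
        K′ , s′ ◅ ε , synced , trans (untouched (λ x⋠x → x⋠x (≼-refl x)) x-unheard) frozen
        where
        x-unheard : ¬ Hears Γ′ (actor s) x (action s)
        x-unheard h with _ , v≡y ← subtree-boundary x≡yj (≼-refl x) x⋠v (hears-adj h) =
          silent-mute (transition s) (subst (λ v → Silent (L′ v)) (sym v≡y) y-silent) h

      AtOrOutside : Word → Set
      AtOrOutside u = ¬ x ≼ u ⊎ u ≡ x

      ∈-at-or-outside : ∀ {u} → AtOrOutside u → u ∈ V Γ ⇔ u ∈ V Γ′
      ∈-at-or-outside (inj₁ x⋠u) = ∈-outside x⋠u
      ∈-at-or-outside (inj₂ refl) =
        mk⇔ (λ _ → subst (_∈ V Γ′) (++-identityʳ x) (from ∈-inside (root∈ N))) (λ _ → x∈)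

      open Desync {Γ} {Γ′} (λ u → ∁? (x ≼?_) u ⊎-dec (u ≟ʷ x)) (inj₂ refl) ∈-at-or-outside

      speak-step : ∀ {K L L′} → Agrees K L → (s : Step P Γ L L′) → ¬ Silent (L′ x) →
                   ∃[ K′ ] (Run Γ′ K K′ × Agrees K′ L′)
      speak-step agrees s x-spoken = desync-step agrees s leak
        where
        leak : Confined s
        leak ¬v (inj₂ refl) h = refl , λ x-silent → x-spoken (silent-stays s (¬v ∘ inj₂ ∘ sym) x-silent)
        leak ¬v (inj₁ x⋠u) h
          with v≡x , _ ← subtree-boundary x≡yj (decidable-stable (x ≼? actor s) (¬v ∘ inj₁)) x⋠u (Adj-sym (hears-adj h)) =
          contradiction (inj₂ v≡x) ¬v

      lift-run : ∀ {M} → Run N (initial P) M → Silent (M []) → ∃[ K ] (Run Γ′ (initial P) K × Lifts K M)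
      lift-run EN root-silent =
        simulate Lifts lift-step ((λ _ → refl) , λ _ → refl)
          (proj₂ (within-backward (λ s → step-silent⁻ s []) EN root-silent))

      freeze-run : ∀ {p K L L₁} → Frozen p K L → Run Γ L L₁ → Silent (L₁ y) → Silent (L₁ x) →
                   ∃[ K₁ ] (Run Γ′ K K₁ × Frozen p K₁ L₁)
      freeze-run frozen E y-silent x-silent =
        simulate (Frozen _) freeze-step frozen (proj₂ (within-backward silent⁻ E (y-silent , x-silent)))
        where
        silent⁻ : ∀ {L L′} → Step P Γ L L′ → Silent (L′ y) × Silent (L′ x) → Silent (L y) × Silent (L x)
        silent⁻ s (y-silent′ , x-silent′) = step-silent⁻ s y y-silent′ , step-silent⁻ s x x-silent′

      speak-run : ∀ {K L₁ L} → Agrees K L₁ → BreaksSilence Γ x L₁ L → ∃[ K′ ] (Run Γ′ K K′ × Agrees K′ L)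
      speak-run agrees idle = _ , ε , agrees
      speak-run agrees (breaks s x-spoken rest) =
        let K₂ , E₂ , agrees₂ = speak-step agrees s x-spoken
            K′ , E₃ , agrees′ = simulate Agrees (λ ag (_ , s′ , spoken) → speak-step ag s′ spoken) agrees₂
                                  (within-forward (λ s′ → step-¬silent s′ x) rest x-spoken)
        in K′ , E₂ ◅◅ E₃ , agrees′

      -- First N runs in place while Γ′ is otherwise idle; then Γ runs outside the subtree up to L₁, with
      -- x waiting in the state it reaches in N; then Γ resumes with x, and the grafted vertices below x
      -- never act again.
      graft-run : ∀ {M L₁ L} → Run N (initial P) M → Silent (M []) →
                  Run Γ (initial P) L₁ → Silent (L₁ y) → Silent (L₁ x) → M [] ≡ L₁ x → BreaksSilence Γ x L₁ L →
                  ∃[ K ] (Run Γ′ (initial P) K × ∀ {u} → ¬ x ≼ u → K u ≡ L u)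
      graft-run {L₁ = L₁} EN root-silent E₁ y-silent x-silent M[]≡L₁x rest =
        let K₀ , E₀ , inside₀ , outside₀ = lift-run EN root-silent
            K₁ , E₁′ , outside₁ , frozen₁ =
              freeze-run {L₁ x} (outside₀ , trans (cong K₀ (sym (++-identityʳ x))) (trans (inside₀ []) M[]≡L₁x))
                E₁ y-silent x-silent
            K , E₂ , agrees = speak-run (at-or-outside outside₁ , inj₁ frozen₁) rest
        in K , E₀ ◅◅ E₁′ ◅◅ E₂ , λ x⋠u → proj₁ agrees (inj₁ x⋠u) λ { refl → x⋠u (≼-refl x) }
        where
        at-or-outside : ∀ {K L : Labelling P} → (∀ {u} → ¬ x ≼ u → K u ≡ L u) →
                        ∀ {u} → AtOrOutside u → u ≢ x → K u ≡ L u
        at-or-outside outside (inj₁ x⋠u) _   = outside x⋠u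
        at-or-outside outside (inj₂ u≡x) u≢x = contradiction u≡x u≢x

    record ParentFirst (Γ : TreeTopology P) (c d : Word) (L : Labelling P) : Set where
      field
        L₁        : Labelling P
        run₁      : Run Γ (initial P) L₁
        c-spoken  : ¬ Silent (L₁ c)
        d-silent  : Silent (L₁ d)
        rest      : Run Γ L₁ L

    -- d breaks silence no later than c, possibly never.
    record ChildFirst (Γ : TreeTopology P) (c d : Word) (L : Labelling P) : Set where
      field
        L₁        : Labelling P
        run₁      : Run Γ (initial P) L₁
        c-silent  : Silent (L₁ c)
        d-silent  : Silent (L₁ d)
        rest      : BreaksSilence Γ d L₁ L

    speaking-order : ∀ {Γ L} c d → Run Γ (initial P) L → ParentFirst Γ c d L ⊎ ChildFirst Γ c d L
    speaking-order {Γ} {L} c d E = scan ε (silent-initial c) (silent-initial d) E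
      where
      scan : ∀ {L₀} → Run Γ (initial P) L₀ → Silent (L₀ c) → Silent (L₀ d) → Run Γ L₀ L →
             ParentFirst Γ c d L ⊎ ChildFirst Γ c d L
      scan E₀ c-silent d-silent ε = inj₂ (record { run₁ = E₀ ; c-silent = c-silent ; d-silent = d-silent ; rest = idle })
      scan E₀ c-silent d-silent (_◅_ {j = L₁} s ss) with silent? (L₁ d) | silent? (L₁ c)
      ... | no d-spoken   | _ =
        inj₂ (record { run₁ = E₀ ; c-silent = c-silent ; d-silent = d-silent ; rest = breaks s d-spoken ss })
      ... | yes d-silent₁ | yes c-silent₁ = scan (E₀ ◅◅ s ◅ ε) c-silent₁ d-silent₁ ss
      ... | yes d-silent₁ | no c-spoken =
        inj₁ (record { run₁ = E₀ ◅◅ s ◅ ε ; c-spoken = c-spoken ; d-silent = d-silent₁ ; rest = ss })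

    Shallow : TreeTopology P → Set
    Shallow Γ = ∀ {u} → u ∈ V Γ → length u < nQ

    SmallerReach : (TreeTopology P → ℕ) → TreeTopology P → Fin nQ → Set
    SmallerReach μ Γ p = ∃[ Γ′ ] (μ Γ′ < μ Γ × RootReachable Γ′ p)

    module Shortening {Γ : TreeTopology P} {L : Labelling P} (E : Run Γ (initial P) L) (root-silent : Silent (L []))
                      {u : Word} (u∈ : u ∈ V Γ) (nQ≤u : nQ ≤ length u) where

      a : ℕ → Word
      a i = take i u

      a∈ : ∀ i → a i ∈ V Γ
      a∈ i = ≼-closed Γ (take-≼ i u) u∈

      a-suc : ∀ {i} → i < nQ → ∃[ k ] (a (suc i) ≡ a i ++ [ k ])
      a-suc i<nQ = take-suc u (ℕ.<-≤-trans i<nQ nQ≤u)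

      a-length : ∀ {i} → i ≤ nQ → length (a i) ≡ i
      a-length i≤nQ = length-take-≤ u (ℕ.≤-trans i≤nQ nQ≤u)

      a-suc≢[] : ∀ {i} → i < nQ → a (suc i) ≢ []
      a-suc≢[] i<nQ = child≢[] (proj₂ (a-suc i<nQ))

      root-never-first : ¬ ParentFirst Γ (a 0) (a 1) L
      root-never-first pf = run-¬silent rest [] c-spoken root-silent
        where open ParentFirst pf

      prune-at : ∀ {i} → suc i < nQ → ParentFirst Γ (a (suc i)) (a (suc (suc i))) L → SmallerReach size Γ (L [])
      prune-at {i} 1+i<nQ pf =
        let _ , d≡ck = a-suc 1+i<nQ
            K , E′ , agree = Pruning.prune-run d≡ck run₁ c-spoken d-silent rest
        in _ , size-prune {Γ} {d≢[] = child≢[] d≡ck} (a∈ (suc (suc i))) ,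
           K , E′ , agree (a-suc≢[] 1+i<nQ ∘ ≼[]⇒≡[]) (a-suc≢[] (ℕ.<⇒≤ 1+i<nQ) ∘ sym)
        where open ParentFirst pf

      project-at : ∀ {i} (i<nQ : i < nQ) (cf : ChildFirst Γ (a i) (a (suc i)) L) →
                   RootReachable (subtree Γ (a (suc i)) (a∈ (suc i))) (ChildFirst.L₁ cf (a (suc i)))
      project-at i<nQ cf = Projection.project (proj₂ (a-suc i<nQ)) (a∈ _) run₁ c-silent
        where open ChildFirst cf

      graft-at : ∀ {i i′} → i < i′ → i′ < nQ →
                 (cf : ChildFirst Γ (a i) (a (suc i)) L) (cf′ : ChildFirst Γ (a i′) (a (suc i′)) L) →
                 ChildFirst.L₁ cf (a (suc i)) ≡ ChildFirst.L₁ cf′ (a (suc i′)) → SmallerReach size Γ (L [])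
      graft-at {i} {i′} i<i′ i′<nQ cf cf′ same =
        let i<nQ = ℕ.<-trans i<i′ i′<nQ
            _ , x≡yk = a-suc i<nQ
            M , EN , M[]≡ = project-at i′<nQ cf′
            K , E′ , agree = Grafting.graft-run x≡yk (a∈ (suc i)) EN (subst Silent (sym M[]≡) (ChildFirst.d-silent cf′))
                               run₁ c-silent d-silent (trans M[]≡ (sym same)) rest
        in _ , size-graft-subtree {Γ} {x∈ = a∈ (suc i)} {x≢[] = child≢[] x≡yk} {z∈ = a∈ (suc i′)}
                 (take-≼-take u (s≤s (ℕ.<⇒≤ i<i′)))
                 (subst₂ _<_ (sym (a-length i<nQ)) (sym (a-length i′<nQ)) (s≤s i<i′)) ,
           K , E′ , agree (a-suc≢[] i<nQ ∘ ≼[]⇒≡[])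
        where open ChildFirst cf

      module _ (child-first : ∀ i → i < nQ → ChildFirst Γ (a i) (a (suc i)) L) where

        state : ∀ i → i < suc nQ → Fin nQ
        state zero    _          = L []
        state (suc i) (s≤s i<nQ) = ChildFirst.L₁ (child-first i i<nQ) (a (suc i))

        repeated : ∀ {i i′} (i≤nQ : i < suc nQ) (i′≤nQ : i′ < suc nQ) → i < i′ → state i i≤nQ ≡ state i′ i′≤nQ →
                   SmallerReach size Γ (L [])
        repeated {zero} {suc i′} _ (s≤s i′<nQ) _ same =
          let K , E′ , K[]≡ = project-at i′<nQ (child-first i′ i′<nQ)
          in _ , size-subtree {Γ} {x∈ = a∈ (suc i′)} (a-suc≢[] i′<nQ) , K , E′ , trans K[]≡ (sym same)
        repeated {suc i} {suc i′} (s≤s i<nQ) (s≤s i′<nQ) (s≤s i<i′) same =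
          graft-at i<i′ i′<nQ (child-first i i<nQ) (child-first i′ i′<nQ) same

        state-repeats : SmallerReach size Γ (L [])
        state-repeats with k , k′ , k<k′ , same ← pigeonhole (ℕ.n<1+n nQ) (λ k → state (toℕ k) (toℕ<n k)) =
          repeated (toℕ<n k) (toℕ<n k′) k<k′ same

      shorten : SmallerReach size Γ (L [])
      shorten with all-or-any nQ (λ i _ → swap (speaking-order (a i) (a (suc i)) E))
      ... | inj₁ child-first         = state-repeats child-first
      ... | inj₂ (zero , _ , pf)     = contradiction pf root-never-first
      ... | inj₂ (suc i , i<nQ , pf) = prune-at i<nQ pf

    silent-shallow : ∀ Γ → Acc _<_ (size Γ) → ∀ {p} → Silent p → RootReachable Γ p →
                     ∃[ Γ′ ] (Shallow Γ′ × RootReachable Γ′ p)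
    silent-shallow Γ (acc smaller) p-silent (L , E , L[]≡p) with any? (λ u → nQ ℕ.≤? length u) (V Γ)
    ... | no none = Γ , (λ u∈ → ℕ.≰⇒> (none ∘ lose u∈)) , L , E , L[]≡p
    ... | yes deep with u , u∈ , nQ≤u ← find deep
      with Γ′ , Γ′<Γ , K , E′ , K[]≡L[] ← Shortening.shorten E (subst Silent (sym L[]≡p) p-silent) u∈ nQ≤u =
      silent-shallow Γ′ (smaller Γ′<Γ) p-silent (K , E′ , trans K[]≡L[] L[]≡p)

    Deep : Word → Set
    Deep u = nQ + 1 < length u

    deep? : ∀ u → Dec (Deep u)
    deep? u = nQ + 1 ℕ.<? length u

    deep-shape : ∀ {u} → Deep u → ∃[ c₀ ] ∃[ c₁ ] ∃[ w ] (u ≡ c₀ ∷ c₁ ∷ w)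
    deep-shape {c₀ ∷ c₁ ∷ w} _               = c₀ , c₁ , w , refl
    deep-shape {_ ∷ []}      (s≤s nQ+1≤0) with () ← ℕ.m+n≤o⇒n≤o nQ nQ+1≤0

    shallow-below-grandchild : ∀ c₀ c₁ {w} → length w < nQ → ¬ Deep (c₀ ∷ c₁ ∷ w)
    shallow-below-grandchild _ _ {w} w<nQ = ℕ.≤⇒≯ (subst (suc (suc (length w)) ≤_) (ℕ.+-comm 1 nQ) (s≤s w<nQ))

    Bounded : Fin nQ → Set
    Bounded q = ∃[ Γ ] (CoverableWith P Γ q × DepthBounded P Γ (nQ + 1))

    module Trimming {Γ : TreeTopology P} {L : Labelling P} (E : Run Γ (initial P) L)
                    {c₀ c₁ : ℕ} {w : Word} (u∈ : c₀ ∷ c₁ ∷ w ∈ V Γ) (u-deep : Deep (c₀ ∷ c₁ ∷ w)) where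

      c d : Word
      c = c₀ ∷ []
      d = c ++ [ c₁ ]

      d≢[] : d ≢ []
      d≢[] = child≢[] {y = c} refl

      d∈ : d ∈ V Γ
      d∈ = ≼-closed Γ (w , refl) u∈

      root-outside : ¬ d ≼ []
      root-outside = d≢[] ∘ ≼[]⇒≡[]

      pruned-fewer : count deep? (prune Γ d d≢[]) < count deep? Γ
      pruned-fewer = count-prune deep? {Γ} {d} {d≢[]} u∈ u-deep (w , refl)

      prune-grandchild : ParentFirst Γ c d L → SmallerReach (count deep?) Γ (L [])
      prune-grandchild pf =
        let K , E′ , agree = Pruning.prune-run refl run₁ c-spoken d-silent rest
        in _ , pruned-fewer , K , E′ , agree root-outside λ ()
        where open ParentFirst pf

      graft-grandchild : ChildFirst Γ c d L → SmallerReach (count deep?) Γ (L [])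
      graft-grandchild cf =
        let M , EN , M[]≡ = Projection.project refl d∈ run₁ c-silent
            N , N-shallow , M′ , EN′ , M′[]≡ =
              silent-shallow (subtree Γ d d∈) (<-wellFounded _) d-silent (M , EN , M[]≡)
            K , E′ , agree =
              Grafting.graft-run refl d∈ EN′ (subst Silent (sym M′[]≡) d-silent) run₁ c-silent d-silent M′[]≡ rest
            not-deep : ∀ {v} → v ∈ V N → ¬ Deep (d ++ v)
            not-deep {v} v∈ = shallow-below-grandchild c₀ c₁ {v} (N-shallow v∈)
        in _ , subst (_< count deep? Γ) (sym (count-graft deep? {Γ} {N} {d} {d∈} {d≢[]} not-deep)) pruned-fewer ,
           K , E′ , agree root-outside
        where open ChildFirst cf

      trim : SmallerReach (count deep?) Γ (L [])
      trim with speaking-order c d E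
      ... | inj₁ pf = prune-grandchild pf
      ... | inj₂ cf = graft-grandchild cf

    bounded-cover : ∀ Γ → Acc _<_ (count deep? Γ) → ∀ {q} → RootReachable Γ q → Bounded q
    bounded-cover Γ (acc fewer) (L , E , L[]≡q) with any? deep? (V Γ)
    ... | no none = Γ , (L , E , [] , root∈ Γ , L[]≡q) , λ u u∈ → ℕ.≮⇒≥ (none ∘ lose u∈)
    ... | yes some-deep with u , u∈ , u-deep ← find some-deep with deep-shape {u} u-deep
    ...   | _ , _ , _ , refl with Γ′ , Γ′<Γ , K , E′ , K[]≡L[] ← Trimming.trim E u∈ u-deep =
      bounded-cover Γ′ (fewer Γ′<Γ) (K , E′ , trans K[]≡L[] L[]≡q)

mainTheorem13 : (P : Protocol) → TwoPhaseBounded P → (qf : Fin (Protocol.nQ P)) → ∃[ Γ ] CoverableWith P Γ qf → ∃[ Γ ] (CoverableWith P Γ qf × DepthBounded P Γ (Protocol.nQ P + 1))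
mainTheorem13 P tpb qf (Γ , L , E , v , v∈ , Lv≡qf) =
  let Γ′ , K , E′ , K[]≡Lv = reroot P v∈ E
  in bounded-cover P tpb Γ′ (<-wellFounded _) (K , E′ , trans K[]≡Lv Lv≡qf)
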